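{- Let $(G,\mathcal{T},(A^\circ,B^\circ),k)$ be a Terminal Separation instance in which $(A^\circ,B^\circ)$ is maximal. If $A$ is a terminal-free $A^\circ$-extension with $d(A) - d(A^\circ) \leq 0$, then $A = A^\circ$.
   Context: Graphs may have multiple edges but no loops; $d(A)$ is the number of edges with exactly one endpoint in $A$. A terminal separation for a family $\mathcal{T}$ of pairwise disjoint terminal pairs is a pair $(A,B)$ of disjoint vertex sets such that every pair either has one terminal in $A$ and the other in $B$, or is disjoint from $A\cup B$; $(A',B')$ extends $(A,B)$ if $A\subseteq A'$, $B\subseteq B'$; its cost is $(d(A)+d(B))/2$. In the instance, every terminal has degree at most one, and $(A^\circ,B^\circ)$ is a terminal separation; it is maximal if every other terminal separation extending it has strictly larger cost. A set $A$ is an $A^\circ$-extension if $A^\circ\subseteq A\subseteq V(G)\setminus B^\circ$; it is terminal-free if $A\setminus A^\circ$ contains no terminal. -}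

module Defs where

open import Data.Nat using (ℕ; _+_; _≤_; _<_)
open import Data.Fin using (Fin)
open import Data.Bool using (Bool; true; false; _xor_; _∧_; not)
open import Data.List using (List; []; _∷_; length; filter; concatMap)
open import Data.List.Membership.Propositional using (_∈_)
open import Data.List.Relation.Unary.All using (All)
open import Data.List.Relation.Unary.Unique.Propositional using (Unique)
open import Data.Product using (_×_; _,_; proj₁; proj₂; Σ)
open import Data.Sum using (_⊎_)
open import Relation.Binary.PropositionalEquality using (_≡_; _≢_)
open import Relation.Nullary using (¬_)
open import Data.Bool.Properties using (T?)
open import Data.Fin using (_≟_)
open import Relation.Nullary.Decidable using (⌊_⌋)
open import Data.Bool using (_∨_)

-- A multigraph on vertex set Fin n: a list of edges (pairs of endpoints);
-- parallel edges are allowed (repeated list entries).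
Edge : ℕ → Set
Edge n = Fin n × Fin n

Graph : ℕ → Set
Graph n = List (Edge n)

Loopless : ∀ {n} → Graph n → Set
Loopless G = All (λ e → proj₁ e ≢ proj₂ e) G

VSet : ℕ → Set
VSet n = Fin n → Bool

d : ∀ {n} → Graph n → VSet n → ℕ
d G A = length (filter (λ e → T? (A (proj₁ e) xor A (proj₂ e))) G)

deg : ∀ {n} → Graph n → Fin n → ℕ
deg G v = length (filter (λ e → T? (⌊ proj₁ e ≟ v ⌋ ∨ ⌊ proj₂ e ≟ v ⌋)) G)

TermPairs : ℕ → Set
TermPairs n = List (Fin n × Fin n)

terminals : ∀ {n} → TermPairs n → List (Fin n)
terminals T = concatMap (λ p → proj₁ p ∷ proj₂ p ∷ []) T

-- pairwise disjoint pairs (each of two distinct terminals): all terminals distinct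
PairwiseDisjoint : ∀ {n} → TermPairs n → Set
PairwiseDisjoint T = Unique (terminals T)

IsTerminal : ∀ {n} → TermPairs n → Fin n → Set
IsTerminal T v = v ∈ terminals T

_∈ˢ_ : ∀ {n} → Fin n → VSet n → Set
v ∈ˢ A = A v ≡ true

_∉ˢ_ : ∀ {n} → Fin n → VSet n → Set
v ∉ˢ A = A v ≡ false

Disjoint : ∀ {n} → VSet n → VSet n → Set
Disjoint A B = ∀ v → ¬ (v ∈ˢ A × v ∈ˢ B)

_⊆ˢ_ : ∀ {n} → VSet n → VSet n → Set
A ⊆ˢ B = ∀ v → v ∈ˢ A → v ∈ˢ B

_≐_ : ∀ {n} → VSet n → VSet n → Set
A ≐ B = ∀ v → A v ≡ B v

IsTerminalSeparation : ∀ {n} → TermPairs n → VSet n → VSet n → Set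
IsTerminalSeparation T A B =
  Disjoint A B ×
  All (λ p → (proj₁ p ∈ˢ A × proj₂ p ∈ˢ B)
           ⊎ (proj₁ p ∈ˢ B × proj₂ p ∈ˢ A)
           ⊎ ((proj₁ p ∉ˢ A × proj₁ p ∉ˢ B) × (proj₂ p ∉ˢ A × proj₂ p ∉ˢ B))) T

Extends : ∀ {n} → (VSet n × VSet n) → (VSet n × VSet n) → Set
Extends (A′ , B′) (A , B) = A ⊆ˢ A′ × B ⊆ˢ B′

-- cost(A,B) = (d(A)+d(B))/2; we compare twice the cost, d(A)+d(B)
cost2 : ∀ {n} → Graph n → VSet n → VSet n → ℕ
cost2 G A B = d G A + d G B

Maximal : ∀ {n} → Graph n → TermPairs n → VSet n → VSet n → Set
Maximal {n} G T A° B° =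
  ∀ (A′ B′ : VSet n) → IsTerminalSeparation T A′ B′ → Extends (A′ , B′) (A° , B°) →
    ¬ (A′ ≐ A° × B′ ≐ B°) → cost2 G A° B° < cost2 G A′ B′

record Instance (n : ℕ) : Set where
  field
    G : Graph n
    T : TermPairs n
    A° : VSet n
    B° : VSet n
    k : ℕ
    loopless : Loopless G
    disjointPairs : PairwiseDisjoint T
    termDeg : ∀ v → IsTerminal T v → deg G v ≤ 1
    sep : IsTerminalSeparation T A° B°

IsExtension : ∀ {n} → VSet n → VSet n → VSet n → Set
IsExtension A° B° A = A° ⊆ˢ A × (∀ v → v ∈ˢ A → v ∉ˢ B°)

TerminalFree : ∀ {n} → TermPairs n → VSet n → VSet n → Set
TerminalFree T A° A = ∀ v → v ∈ˢ A → v ∉ˢ A° → ¬ IsTerminal T v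

-- Enlarging A° to A keeps (A, B°) a terminal separation: the new vertices
-- are not terminals, so no terminal pair changes status, and A stays
-- disjoint from B°. It extends (A°, B°) at cost d(A) + d(B°) ≤ d(A°) + d(B°),
-- so maximality forces it to be (A°, B°) itself.
module Submission where

open import Defs
open import Data.Nat using (ℕ; _≤_)
open import Data.Nat.Properties using (+-monoˡ-≤; ≤⇒≯)
open import Data.Bool using (Bool; true; false)
open import Data.Bool.Properties using () renaming (_≟_ to _≟ᵇ_)
open import Data.Fin using (Fin)
open import Data.List.Relation.Unary.All as All using (All)
open import Data.List.Relation.Unary.Any as Any using (here; there)
open import Data.List.Membership.Propositional using (_∈_)
open import Data.List.Membership.Propositional.Properties using (∈-concatMap⁺)
open import Data.Product using (_×_; _,_; proj₁; proj₂)
open import Data.Sum using (_⊎_; inj₁; inj₂)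
open import Function using (id; _∘_; _$_)
open import Relation.Binary.PropositionalEquality using (_≡_; refl; sym; trans)
open import Relation.Nullary using (¬_; contradiction)
open import Relation.Nullary.Decidable using (decidable-stable)

private
  variable
    n : ℕ

-- Definitionally the per-pair condition of IsTerminalSeparation.
Separates : VSet n → VSet n → Fin n × Fin n → Set
Separates A B p = (proj₁ p ∈ˢ A × proj₂ p ∈ˢ B)
                ⊎ (proj₁ p ∈ˢ B × proj₂ p ∈ˢ A)
                ⊎ ((proj₁ p ∉ˢ A × proj₁ p ∉ˢ B) × (proj₂ p ∉ˢ A × proj₂ p ∉ˢ B))

∈-terminals⁺ : {T : TermPairs n} {p : Fin n × Fin n} → p ∈ T →
               IsTerminal T (proj₁ p) × IsTerminal T (proj₂ p)
∈-terminals⁺ p∈T = ∈-concatMap⁺ _ (Any.map (λ { refl → here refl }) p∈T)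
                 , ∈-concatMap⁺ _ (Any.map (λ { refl → there (here refl) }) p∈T)

contraposeᵇ : {b c : Bool} → (b ≡ true → c ≡ true) → c ≡ false → b ≡ false
contraposeᵇ {false} _   _    = refl
contraposeᵇ {true}  b⇒c refl with () ← b⇒c refl

separates-extendˡ : {A° A B : VSet n} {p : Fin n × Fin n} → A° ⊆ˢ A →
                    (proj₁ p ∈ˢ A → proj₁ p ∈ˢ A°) → (proj₂ p ∈ˢ A → proj₂ p ∈ˢ A°) →
                    Separates A° B p → Separates A B p
separates-extendˡ A°⊆A _  _  (inj₁ (a∈A° , b∈B))       = inj₁ (A°⊆A _ a∈A° , b∈B)
separates-extendˡ A°⊆A _  _  (inj₂ (inj₁ (a∈B , b∈A°))) = inj₂ (inj₁ (a∈B , A°⊆A _ b∈A°))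
separates-extendˡ _    a⇒ b⇒ (inj₂ (inj₂ ((a∉A° , a∉B) , (b∉A° , b∉B)))) =
  inj₂ (inj₂ ((contraposeᵇ a⇒ a∉A° , a∉B) , (contraposeᵇ b⇒ b∉A° , b∉B)))

terminalSeparation-extendˡ : {T : TermPairs n} {A° A B : VSet n} →
  IsTerminalSeparation T A° B → A° ⊆ˢ A → (∀ v → v ∈ˢ A → v ∉ˢ B) →
  (∀ v → IsTerminal T v → v ∈ˢ A → v ∈ˢ A°) →
  IsTerminalSeparation T A B
terminalSeparation-extendˡ {T = T} {A°} {A} {B} (_ , separated) A°⊆A A∩B=∅ terminal∈A⇒∈A° =
    (λ v (v∈A , v∈B) → contradiction (trans (sym (A∩B=∅ v v∈A)) v∈B) λ ())
  , All.tabulate λ p∈T →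
      let (a∈T , b∈T) = ∈-terminals⁺ {T = T} p∈T in
      separates-extendˡ {A° = A°} {A} {B} A°⊆A (terminal∈A⇒∈A° _ a∈T) (terminal∈A⇒∈A° _ b∈T)
                        (All.lookup separated p∈T)

terminalFree⇒terminal∈A° : {T : TermPairs n} {A° A : VSet n} → TerminalFree T A° A →
                           ∀ v → IsTerminal T v → v ∈ˢ A → v ∈ˢ A°
terminalFree⇒terminal∈A° {A° = A°} tf v v∈T v∈A with A° v in eq
... | true  = refl
... | false = contradiction v∈T (tf v v∈A eq)

Maximal⇒cost-≤⇒≐ : {G : Graph n} {T : TermPairs n} {A° B° A B : VSet n} →
  Maximal G T A° B° → IsTerminalSeparation T A B → Extends (A , B) (A° , B°) →
  cost2 G A B ≤ cost2 G A° B° → A ≐ A° × B ≐ B°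
Maximal⇒cost-≤⇒≐ {A° = A°} {B°} {A} {B} max sep ext cost≤ =
    (λ v → decidable-stable (A v ≟ᵇ A° v) λ ne → unchanged (ne ∘ (_$ v) ∘ proj₁))
  , (λ v → decidable-stable (B v ≟ᵇ B° v) λ ne → unchanged (ne ∘ (_$ v) ∘ proj₂))
  where
  -- Maximality only refutes a change; equality of Booleans is decidable, so this suffices.
  unchanged : ¬ ¬ (A ≐ A° × B ≐ B°)
  unchanged changed = ≤⇒≯ cost≤ (max A B sep ext changed)

lemma4p2 : ∀ {n} (I : Instance n) → let open Instance I in
    Maximal G T A° B° →
    ∀ (A : VSet n) → IsExtension A° B° A → TerminalFree T A° A →
    d G A ≤ d G A° →
    A ≐ A°
lemma4p2 I max A (A°⊆A , A∩B°=∅) tf dA≤dA° =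
  proj₁ (Maximal⇒cost-≤⇒≐ {G = G} {T} max sepA (A°⊆A , λ _ → id) (+-monoˡ-≤ (d G B°) dA≤dA°))
  where
  open Instance I
  sepA : IsTerminalSeparation T A B°
  sepA = terminalSeparation-extendˡ sep A°⊆A A∩B°=∅ (terminalFree⇒terminal∈A° {T = T} tf)
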